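{- Let $\mathcal{C}$ be a class of finite digraphs for which there is a natural number $N$ such that every disjoint edge set in every member of $\mathcal{C}$ has size at most $N$. Then $\mathcal{C}$ is well quasi-ordered under both the standard and the strong homomorphic image orderings.
   Context: A digraph is a set $D$ with a binary relation $E(D)\subseteq D\times D$ (its edges). Edges $(a_1,b_1),\dots,(a_k,b_k)$ of $D$ are disjoint (forming a disjoint edge set of size $k$) if all the vertices $a_1,\dots,a_k,b_1,\dots,b_k$ are distinct. For digraphs $S,T$, a map $\phi:S\to T$ is a homomorphism if $(s_1,s_2)\in E(S)$ implies $(\phi(s_1),\phi(s_2))\in E(T)$; it is strong if moreover $\{(\phi(s_1),\phi(s_2)):(s_1,s_2)\in E(S)\}=E(T)\cap(\phi(S)\times\phi(S))$. Surjective (strong) homomorphisms are (strong) epimorphisms. Homomorphic image ordering: $A\preceq B$ iff there is an epimorphism $B\to A$; strong homomorphic image ordering: $A\preceq B$ iff there is a strong epimorphism $B\to A$. Well quasi-ordered means: no infinite strictly decreasing sequence and no infinite antichain. -}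

module Defs where

open import Data.Nat using (ℕ; _≤_; suc)
open import Data.Fin using (Fin)
open import Data.Bool using (Bool; true)
open import Data.Sum using (_⊎_; inj₁; inj₂)
open import Data.Product using (Σ; ∃; ∃-syntax; _×_; _,_; proj₁; proj₂)
open import Relation.Binary.PropositionalEquality using (_≡_)
open import Relation.Nullary using (¬_)
open import Function.Definitions using (Injective)

record Digraph : Set where
  constructor digraph
  field
    size : ℕ
    edge : Fin size → Fin size → Bool

open Digraph public

Vertex : Digraph → Set
Vertex D = Fin (size D)

Edge : (D : Digraph) → Vertex D → Vertex D → Set
Edge D a b = edge D a b ≡ true

endpoints : {V : Set} {k : ℕ} → (Fin k → V) → (Fin k → V) → Fin k ⊎ Fin k → V
endpoints s t (inj₁ i) = s i
endpoints s t (inj₂ i) = t i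

record DisjointEdgeSet (D : Digraph) (k : ℕ) : Set where
  field
    src : Fin k → Vertex D
    tgt : Fin k → Vertex D
    isEdge : ∀ i → Edge D (src i) (tgt i)
    distinct : Injective _≡_ _≡_ (endpoints src tgt)

IsHom : (S T : Digraph) → (Vertex S → Vertex T) → Set
IsHom S T φ = ∀ s₁ s₂ → Edge S s₁ s₂ → Edge T (φ s₁) (φ s₂)

IsStrongHom : (S T : Digraph) → (Vertex S → Vertex T) → Set
IsStrongHom S T φ = IsHom S T φ ×
  (∀ s₁ s₂ → Edge T (φ s₁) (φ s₂) →
     ∃[ u₁ ] ∃[ u₂ ] (Edge S u₁ u₂ × φ u₁ ≡ φ s₁ × φ u₂ ≡ φ s₂))

Surjective : {A B : Set} → (A → B) → Set
Surjective {A} {B} f = ∀ (b : B) → ∃[ a ] (f a ≡ b)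

_⪯hom_ : Digraph → Digraph → Set
A ⪯hom B = ∃[ φ ] (IsHom B A φ × Surjective φ)

_⪯strong_ : Digraph → Digraph → Set
A ⪯strong B = ∃[ φ ] (IsStrongHom B A φ × Surjective φ)

Class : Set₁
Class = Digraph → Set

Member : Class → Set
Member 𝒞 = Σ Digraph 𝒞

StrictlyBelow : (Digraph → Digraph → Set) → Digraph → Digraph → Set
StrictlyBelow _⪯_ A B = A ⪯ B × ¬ (B ⪯ A)

NoInfiniteDescending : (Digraph → Digraph → Set) → Class → Set
NoInfiniteDescending _⪯_ 𝒞 =
  ¬ (Σ (ℕ → Member 𝒞) λ f →
       ∀ i → StrictlyBelow _⪯_ (proj₁ (f (suc i))) (proj₁ (f i)))

NoInfiniteAntichain : (Digraph → Digraph → Set) → Class → Set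
NoInfiniteAntichain _⪯_ 𝒞 =
  ¬ (Σ (ℕ → Member 𝒞) λ f →
       ∀ i j → ¬ (i ≡ j) → ¬ (proj₁ (f i) ⪯ proj₁ (f j)))

WellQuasiOrdered : (Digraph → Digraph → Set) → Class → Set
WellQuasiOrdered _⪯_ 𝒞 = NoInfiniteDescending _⪯_ 𝒞 × NoInfiniteAntichain _⪯_ 𝒞

DisjointEdgeBounded : Class → ℕ → Set
DisjointEdgeBounded 𝒞 N = ∀ D → 𝒞 D → ∀ k → DisjointEdgeSet D k → k ≤ N

-- The endpoints of a maximal disjoint edge set form a set C of at most 2N vertices
-- meeting every edge that is not a loop.  Record for each vertex v its type: which
-- vertex of C it is, whether it has a loop, and its edges to and from C.  Types are
-- bit lists of bounded length, so a digraph is summarised by finitely many natural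
-- numbers: the size of C and the number of vertices of each type.  If the sizes agree,
-- B has at least as many vertices of every type as A, and every type occurring in B
-- occurs in A, then a type-preserving surjection B → A exists, and it is a strong
-- epimorphism: edges meeting C are recorded in the types, and all other edges are
-- loops.  Dickson's lemma, in Coquand's constructive form via almost-full relations,
-- gives i < j with A_i ⪯ A_j in every sequence, which rules out infinite antichains
-- and infinite strictly descending chains.

module Submission where

open import Defs
open import Level using (0ℓ)
open import Data.Nat using (ℕ; zero; suc; _+_; _∸_; _≤_; _<_; z≤n; s≤s; _≤?_)
open import Data.Nat.Properties
  using ( ≤-refl; ≤-reflexive; ≤-trans; ≤-pred; ≰⇒>; <⇒≱; <⇒≢; n≢0⇒n>0; suc-injective
        ; +-identityʳ; +-suc; +-mono-≤; +-cancelˡ-≤; m≤n⇒m<n∨m≡n; m∸n+n≡m; +-commutativeSemigroup)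
  renaming (_≟_ to _≟ℕ_)
open import Data.Fin using (Fin; zero; suc; punchIn; punchOut; splitAt; join)
open import Data.Fin.Properties using (any?; punchIn-punchOut; splitAt-join) renaming (_≟_ to _≟ᶠ_)
open import Data.Bool using (Bool; true; false)
open import Data.Bool.Properties using () renaming (_≟_ to _≟ᵇ_)
open import Data.List using (List; []; _∷_; _++_; map; length; upTo; allFin)
open import Data.List.Properties using (∷-injective; length-map; length-++; length-tabulate; ≡-dec)
open import Data.List.Membership.Propositional using (_∈_)
open import Data.List.Membership.Propositional.Properties
  using (∈-map⁺; ∈-++⁺ˡ; ∈-++⁺ʳ; ∈-allFin; ∈-upTo⁺)
open import Data.List.Relation.Unary.All using (All; []; _∷_; lookup)
open import Data.List.Relation.Unary.Any using (here; there)
import Data.Vec.Functional as Vector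
open import Data.Product using (Σ; ∃-syntax; _×_; _,_; proj₁; proj₂)
open import Data.Sum using (_⊎_; inj₁; inj₂)
import Data.Sum as Sum
open import Data.Empty using (⊥)
open import Function using (_∘_; _on_; id)
open import Function.Definitions using (Injective)
open import Relation.Nullary using (Dec; does; yes; no; ¬_; contradiction)
open import Relation.Nullary.Decidable using (_×-dec_; ¬?; dec-true)
open import Relation.Binary.Core using (Rel; _⇒_)
open import Relation.Binary.Definitions using (DecidableEquality; Reflexive; Transitive)
open import Relation.Binary.Construct.Union using (_∪_)
open import Relation.Binary.Construct.Intersection using (_∩_)
open import Relation.Binary.PropositionalEquality
open import Algebra.Properties.CommutativeSemigroup +-commutativeSemigroup using (x∙yz≈y∙xz)

private
  variable
    I X Y P Q : Set

Rel₀ : Set → Set₁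
Rel₀ X = Rel X 0ℓ

data WFT (X : Set) : Set where
  leaf : WFT X
  node : (X → WFT X) → WFT X

_↾_ : Rel₀ X → X → Rel₀ X
(R ↾ x) y _ = R x y

_↑_ : Rel₀ X → X → Rel₀ X
R ↑ x = R ∪ (R ↾ x)

SecuredBy : Rel₀ X → WFT X → Set
SecuredBy R leaf     = ∀ x y → R x y
SecuredBy R (node f) = ∀ x → SecuredBy (R ↑ x) (f x)

AlmostFull : Rel₀ X → Set
AlmostFull R = ∃[ p ] SecuredBy R p

securedBy-mono : {R S : Rel₀ X} (p : WFT X) → R ⇒ S → SecuredBy R p → SecuredBy S p
securedBy-mono leaf     R⇒S s = λ x y → R⇒S (s x y)
securedBy-mono (node f) R⇒S s = λ x → securedBy-mono (f x) (Sum.map R⇒S R⇒S) (s x)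

almostFull-mono : {R S : Rel₀ X} → R ⇒ S → AlmostFull R → AlmostFull S
almostFull-mono R⇒S (p , s) = p , securedBy-mono p R⇒S s

almostFull-node : {R : Rel₀ X} → (∀ x → AlmostFull (R ↑ x)) → AlmostFull R
almostFull-node h = node (proj₁ ∘ h) , proj₂ ∘ h

almostFull-good : {R : Rel₀ X} → AlmostFull R → (s : ℕ → X) →
                  ∃[ i ] ∃[ j ] (i < j × R (s i) (s j))
almostFull-good (leaf , full) s = 0 , 1 , s≤s z≤n , full (s 0) (s 1)
almostFull-good (node f , sec) s with almostFull-good (f (s 0) , sec (s 0)) (s ∘ suc)
... | i , j , i<j , inj₁ r = suc i , suc j , s≤s i<j , r
... | i , j , i<j , inj₂ r = 0 , suc i , s≤s z≤n , r

securedBy-on : {R : Rel₀ X} (f : Y → X) (p : WFT X) → SecuredBy R p → AlmostFull (R on f)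
securedBy-on f leaf     s = leaf , λ x y → s (f x) (f y)
securedBy-on f (node g) s = almostFull-node λ y → securedBy-on f (g (f y)) (s (f y))

almostFull-on : {R : Rel₀ X} (f : Y → X) → AlmostFull R → AlmostFull (R on f)
almostFull-on f (p , s) = securedBy-on f p s

almostFull-≤⊎≥ : ∀ x → AlmostFull (λ y z → y ≤ z ⊎ x ≤ y)
almostFull-≤⊎≥ zero    = leaf , λ _ _ → inj₂ z≤n
almostFull-≤⊎≥ (suc x) = almostFull-node after
  where
  after : ∀ w → AlmostFull (λ y z → (y ≤ z ⊎ suc x ≤ y) ⊎ (w ≤ y ⊎ suc x ≤ w))
  after w with suc x ≤? w
  ... | yes x<w = leaf , λ _ _ → inj₂ (inj₂ x<w)
  ... | no  x≮w = almostFull-mono (Sum.map inj₁ (inj₁ ∘ ≤-trans w≤x)) (almostFull-≤⊎≥ x)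
    where
    w≤x : w ≤ x
    w≤x with s≤s w≤x ← ≰⇒> x≮w = w≤x

almostFull-≤ : AlmostFull _≤_
almostFull-≤ = almostFull-node almostFull-≤⊎≥

Const : Set → Rel₀ X
Const A _ _ = A

Unary : (X → Set) → Rel₀ X
Unary A y _ = A y

module _ {C R : Rel₀ X} {x : X} where

  ↑-split : ((C ∪ R) ↑ x) ⇒ ((C ↑ x) ∪ (R ↾ x)) ∪ R
  ↑-split (inj₁ (inj₁ c))  = inj₁ (inj₁ (inj₁ c))
  ↑-split (inj₁ (inj₂ r))  = inj₂ r
  ↑-split (inj₂ (inj₁ c))  = inj₁ (inj₁ (inj₂ c))
  ↑-split (inj₂ (inj₂ r))  = inj₁ (inj₂ r)

  ↑-weaken : {S : Rel₀ X} → C ∪ R ⇒ ((C ↑ x) ∪ S) ∪ R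
  ↑-weaken = Sum.map₁ (inj₁ ∘ inj₁)

  ↑-join : ((C ↑ x) ∪ R) ∪ (R ↾ x) ⇒ (C ∪ R) ↑ x
  ↑-join (inj₁ (inj₁ (inj₁ c))) = inj₁ (inj₁ c)
  ↑-join (inj₁ (inj₁ (inj₂ c))) = inj₂ (inj₁ c)
  ↑-join (inj₁ (inj₂ r))        = inj₁ (inj₂ r)
  ↑-join (inj₂ r)               = inj₂ (inj₂ r)

↑-split-const : {C : Rel₀ X} {A : Set} {x : X} → ((C ∪ Const A) ↑ x) ⇒ (C ↑ x) ∪ Const A
↑-split-const = Sum.[ Sum.map₁ inj₁ , Sum.map₁ inj₂ ]′

∪-exchange : {C S Q : Rel₀ X} → (C ∪ S) ∪ Q ⇒ (C ∪ Q) ∪ S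
∪-exchange (inj₁ (inj₁ c)) = inj₁ (inj₁ c)
∪-exchange (inj₁ (inj₂ s)) = inj₂ s
∪-exchange (inj₂ q)        = inj₁ (inj₂ q)

∪-combine : {C R T : Rel₀ X} {y z : X} → (C ∪ R) y z → (C ∪ T) y z → (C ∪ (R ∩ T)) y z
∪-combine (inj₁ c) _        = inj₁ c
∪-combine (inj₂ _) (inj₁ c) = inj₁ c
∪-combine (inj₂ r) (inj₂ t) = inj₂ (r , t)

∩-leafˡ : (q : WFT X) {C R T : Rel₀ X} →
          (∀ y z → (C ∪ R) y z) → SecuredBy (C ∪ T) q → AlmostFull (C ∪ (R ∩ T))
∩-leafˡ q {C} {R} {T} full t = q , securedBy-mono q (∪-combine {C = C} {R} {T} (full _ _)) t

∩-leafʳ : (p : WFT X) {C R T : Rel₀ X} →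
          SecuredBy (C ∪ R) p → (∀ y z → (C ∪ T) y z) → AlmostFull (C ∪ (R ∩ T))
∩-leafʳ p {C} {R} {T} s full = p , securedBy-mono p (λ r → ∪-combine {C = C} {R} {T} r (full _ _)) s

-- Coquand's intuitionistic Ramsey theorem, by a nested induction on the two trees;
-- the relations fixed at x drop from binary to unary to constant.
∩-securedConst : (p q : WFT X) {C : Rel₀ X} {A B : Set} →
                 SecuredBy (C ∪ Const A) p → SecuredBy (C ∪ Const B) q →
                 AlmostFull (C ∪ (Const A ∩ Const B))
∩-securedConst leaf     q    = ∩-leafˡ q
∩-securedConst (node f) leaf = ∩-leafʳ (node f)
∩-securedConst (node f) (node g) {C} {A} {B} s t = almostFull-node λ x →
  almostFull-mono (↑-join {C = C} {Const A ∩ Const B} ∘ inj₁)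
    (∩-securedConst (f x) (g x) {C ↑ x} (securedBy-mono (f x) (↑-split-const {C = C}) (s x))
                                        (securedBy-mono (g x) (↑-split-const {C = C}) (t x)))

∩-step : {C R T : Rel₀ X} {x : X} →
         (∀ p q {D} → SecuredBy (D ∪ (R ↾ x)) p → SecuredBy (D ∪ (T ↾ x)) q →
                      AlmostFull (D ∪ ((R ∩ T) ↾ x))) →
         AlmostFull (((C ↑ x) ∪ (R ↾ x)) ∪ (R ∩ T)) →
         AlmostFull (((C ↑ x) ∪ (T ↾ x)) ∪ (R ∩ T)) →
         AlmostFull ((C ∪ (R ∩ T)) ↑ x)
∩-step {C = C} {R} {T} {x} lower (p₁ , s₁) (p₂ , s₂) =
  almostFull-mono (↑-join {C = C} {R ∩ T})
    (lower p₁ p₂ {(C ↑ x) ∪ (R ∩ T)} (securedBy-mono p₁ (∪-exchange {C = C ↑ x} {R ↾ x} {R ∩ T}) s₁)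
                 (securedBy-mono p₂ (∪-exchange {C = C ↑ x} {T ↾ x} {R ∩ T}) s₂))

∩-securedUnary : (p q : WFT X) {C : Rel₀ X} {A B : X → Set} →
                 SecuredBy (C ∪ Unary A) p → SecuredBy (C ∪ Unary B) q →
                 AlmostFull (C ∪ (Unary A ∩ Unary B))
∩-securedUnary leaf     q    = ∩-leafˡ q
∩-securedUnary (node f) leaf = ∩-leafʳ (node f)
∩-securedUnary (node f) (node g) {C} {A} {B} s t = almostFull-node λ x →
  ∩-step {C = C} {Unary A} {Unary B} (λ p q → ∩-securedConst p q)
    (∩-securedUnary (f x) (node g) {(C ↑ x) ∪ Const (A x)} {A} {B}
       (securedBy-mono (f x) (↑-split {C = C} {Unary A}) (s x))
       (securedBy-mono (node g) (↑-weaken {C = C} {Unary B} {x} {Const (A x)}) t))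
    (∩-securedUnary (node f) (g x) {(C ↑ x) ∪ Const (B x)} {A} {B}
       (securedBy-mono (node f) (↑-weaken {C = C} {Unary A} {x} {Const (B x)}) s)
       (securedBy-mono (g x) (↑-split {C = C} {Unary B}) (t x)))

∩-secured : (p q : WFT X) {C R T : Rel₀ X} →
            SecuredBy (C ∪ R) p → SecuredBy (C ∪ T) q → AlmostFull (C ∪ (R ∩ T))
∩-secured leaf     q    = ∩-leafˡ q
∩-secured (node f) leaf = ∩-leafʳ (node f)
∩-secured (node f) (node g) {C} {R} {T} s t = almostFull-node λ x →
  ∩-step {C = C} {R} {T} (λ p q → ∩-securedUnary p q)
    (∩-secured (f x) (node g) {(C ↑ x) ∪ (R ↾ x)} {R} {T}
       (securedBy-mono (f x) (↑-split {C = C} {R}) (s x))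
       (securedBy-mono (node g) (↑-weaken {C = C} {T} {x} {R ↾ x}) t))
    (∩-secured (node f) (g x) {(C ↑ x) ∪ (T ↾ x)} {R} {T}
       (securedBy-mono (node f) (↑-weaken {C = C} {R} {x} {T ↾ x}) s)
       (securedBy-mono (g x) (↑-split {C = C} {T}) (t x)))

almostFull-∩ : {R T : Rel₀ X} → AlmostFull R → AlmostFull T → AlmostFull (R ∩ T)
almostFull-∩ (p , s) (q , t) =
  almostFull-mono (λ { (inj₁ ()) ; (inj₂ rt) → rt })
    (∩-secured p q {C = Const ⊥} (securedBy-mono p inj₂ s) (securedBy-mono q inj₂ t))


𝟙 : Dec P → ℕ
𝟙 (yes _) = 1
𝟙 (no _)  = 0

𝟙-yes : (d : Dec P) → P → 𝟙 d ≡ 1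
𝟙-yes (yes _) _ = refl
𝟙-yes (no ¬p) p = contradiction p ¬p

𝟙-no : (d : Dec P) → ¬ P → 𝟙 d ≡ 0
𝟙-no (yes p) ¬p = contradiction p ¬p
𝟙-no (no _)  _  = refl

𝟙-≤⇒ : {d : Dec P} {e : Dec Q} → 𝟙 d ≤ 𝟙 e → P → Q
𝟙-≤⇒ {d = yes _} {e = yes q} _  _ = q
𝟙-≤⇒ {d = yes _} {e = no _}  () _
𝟙-≤⇒ {d = no ¬p}             _  p = contradiction p ¬p

almostFull-All : {R : Rel₀ ℕ} → AlmostFull R → (is : List I) →
                 AlmostFull {I → ℕ} (λ v w → All (λ i → R (v i) (w i)) is)
almostFull-All af []       = leaf , λ _ _ → []
almostFull-All af (i ∷ is) =
  almostFull-mono (λ (r , rs) → r ∷ rs)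
    (almostFull-∩ (almostFull-on (λ v → v i) af) (almostFull-All af is))

-- Compare indicator vectors: 𝟙[x = i] ≤ 𝟙[y = i] at i = x forces y = x.
almostFull-≡ : DecidableEquality I → (is : List I) → AlmostFull {I} (λ x y → x ∈ is → x ≡ y)
almostFull-≡ _≟_ is =
  almostFull-mono (λ below x∈is → sym (𝟙-≤⇒ (lookup below x∈is) refl))
    (almostFull-on (λ x i → 𝟙 (x ≟ i)) (almostFull-All almostFull-≤ is))

_⊑_ : ℕ → ℕ → Set
m ⊑ n = m ≤ n × (m ≡ 0 → n ≡ 0)

almostFull-⊑ : AlmostFull _⊑_
almostFull-⊑ = almostFull-mono (λ (m≤n , zeros) → m≤n , 𝟙-≤⇒ zeros)
  (almostFull-∩ almostFull-≤ (almostFull-on (λ n → 𝟙 (n ≟ℕ 0)) almostFull-≤))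

module Counting {T : Set} (_≟_ : DecidableEquality T) where

  count : ∀ {n} → (Fin n → T) → T → ℕ
  count {zero}  _ _ = 0
  count {suc n} f τ = 𝟙 (f zero ≟ τ) + count (f ∘ suc) τ

  count-punchIn : ∀ {n} (f : Fin (suc n) → T) y τ →
                  count f τ ≡ 𝟙 (f y ≟ τ) + count (f ∘ punchIn y) τ
  count-punchIn         f zero    τ = refl
  count-punchIn {suc n} f (suc y) τ = begin
    𝟙 (f zero ≟ τ) + count (f ∘ suc) τ
      ≡⟨ cong (𝟙 (f zero ≟ τ) +_) (count-punchIn (f ∘ suc) y τ) ⟩
    𝟙 (f zero ≟ τ) + (𝟙 (f (suc y) ≟ τ) + count (f ∘ suc ∘ punchIn y) τ)
      ≡⟨ x∙yz≈y∙xz (𝟙 (f zero ≟ τ)) (𝟙 (f (suc y) ≟ τ)) (count (f ∘ suc ∘ punchIn y) τ) ⟩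
    𝟙 (f (suc y) ≟ τ) + (𝟙 (f zero ≟ τ) + count (f ∘ suc ∘ punchIn y) τ)
      ∎
    where open ≡-Reasoning

  count-punchIn-≡ : ∀ {n} (f : Fin (suc n) → T) y {τ} → f y ≡ τ →
                    count f τ ≡ suc (count (f ∘ punchIn y) τ)
  count-punchIn-≡ f y {τ} fy≡τ =
    trans (count-punchIn f y τ) (cong (_+ count (f ∘ punchIn y) τ) (𝟙-yes (f y ≟ τ) fy≡τ))

  count-punchIn-≢ : ∀ {n} (f : Fin (suc n) → T) y {τ} → f y ≢ τ →
                    count f τ ≡ count (f ∘ punchIn y) τ
  count-punchIn-≢ f y {τ} fy≢τ =
    trans (count-punchIn f y τ) (cong (_+ count (f ∘ punchIn y) τ) (𝟙-no (f y ≟ τ) fy≢τ))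

  count-image>0 : ∀ {n} (f : Fin n → T) y → 0 < count f (f y)
  count-image>0 {suc n} f y = subst (0 <_) (sym (count-punchIn-≡ f y refl)) (s≤s z≤n)

  count>0⇒preimage : ∀ {n} (f : Fin n → T) {τ} → 0 < count f τ → ∃[ y ] f y ≡ τ
  count>0⇒preimage {suc n} f {τ} count>0 with f zero ≟ τ
  ... | yes f0≡τ = zero , f0≡τ
  ... | no  _    with y , fy≡τ ← count>0⇒preimage (f ∘ suc) count>0 = suc y , fy≡τ

  LabelledSurjection : ∀ {a b} → (Fin a → T) → (Fin b → T) → Set
  LabelledSurjection t s = ∃[ φ ] (∀ x → s (φ x) ≡ t x) × Surjective φ

  module _ {a b} {t : Fin (suc a) → T} {s : Fin b → T} (y₀ : Fin b) (sy₀ : s y₀ ≡ t zero) where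

    prependRepeated : LabelledSurjection (t ∘ suc) s → LabelledSurjection t s
    prependRepeated (ψ , preserves , onto) = y₀ Vector.∷ ψ , preserves′ , onto′
      where
      preserves′ : ∀ x → s ((y₀ Vector.∷ ψ) x) ≡ t x
      preserves′ zero    = sy₀
      preserves′ (suc x) = preserves x
      onto′ : Surjective (y₀ Vector.∷ ψ)
      onto′ y with x , ψx≡y ← onto y = suc x , ψx≡y

  module _ {a b} {t : Fin (suc a) → T} {s : Fin (suc b) → T}
           (y₀ : Fin (suc b)) (sy₀ : s y₀ ≡ t zero) where

    prependFresh : LabelledSurjection (t ∘ suc) (s ∘ punchIn y₀) → LabelledSurjection t s
    prependFresh (ψ , preserves , onto) = y₀ Vector.∷ punchIn y₀ ∘ ψ , preserves′ , onto′
      where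
      preserves′ : ∀ x → s ((y₀ Vector.∷ punchIn y₀ ∘ ψ) x) ≡ t x
      preserves′ zero    = sy₀
      preserves′ (suc x) = preserves x
      onto′ : Surjective (y₀ Vector.∷ punchIn y₀ ∘ ψ)
      onto′ y with y₀ ≟ᶠ y
      ... | yes y₀≡y = zero , y₀≡y
      ... | no  y₀≢y with x , ψx≡ ← onto (punchOut y₀≢y) =
        suc x , trans (cong (punchIn y₀) ψx≡) (punchIn-punchOut y₀≢y)

  -- Peel off the first point x = 0 of the domain, of label τ = t 0.  If τ is
  -- still over-represented in t, send 0 to any y₀ of label τ and keep y₀ available;
  -- otherwise the counts of τ are equal and y₀ is removed from the codomain too.
  labelledSurjection : ∀ {a b} (t : Fin a → T) (s : Fin b → T) →
                       (∀ τ → count s τ ≤ count t τ) → (∀ x → ∃[ y ] s y ≡ t x) →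
                       LabelledSurjection t s
  labelledSurjection {zero} t s fewer hit =
    (λ ()) , (λ ()) , λ y → contradiction (≤-trans (count-image>0 s y) (fewer (s y))) λ ()
  labelledSurjection {suc a} {zero} t s fewer hit with () ← proj₁ (hit zero)
  labelledSurjection {suc a} {suc b} t s fewer hit
    with y₀ , sy₀ ← hit zero | m≤n⇒m<n∨m≡n (fewer (t zero))
  ... | inj₁ surplus = prependRepeated y₀ sy₀ (labelledSurjection (t ∘ suc) s fewer′ (hit ∘ suc))
    where
    fewer′ : ∀ τ → count s τ ≤ count (t ∘ suc) τ
    fewer′ τ with t zero ≟ τ
    ... | yes refl = ≤-pred (subst (count s (t zero) <_) (count-punchIn-≡ t zero refl) surplus)
    ... | no  t0≢τ = subst (count s τ ≤_) (count-punchIn-≢ t zero t0≢τ) (fewer τ)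
  ... | inj₂ tight =
    prependFresh y₀ sy₀ (labelledSurjection (t ∘ suc) (s ∘ punchIn y₀) fewer′ hit′)
    where
    fewer′ : ∀ τ → count (s ∘ punchIn y₀) τ ≤ count (t ∘ suc) τ
    fewer′ τ = +-cancelˡ-≤ (𝟙 (t zero ≟ τ)) _ _
      (subst (_≤ count t τ) (trans (count-punchIn s y₀ τ) (cong (λ σ → 𝟙 (σ ≟ τ) + _) sy₀))
             (fewer τ))
    remaining : count (s ∘ punchIn y₀) (t zero) ≡ count (t ∘ suc) (t zero)
    remaining = suc-injective (trans (sym (count-punchIn-≡ s y₀ sy₀))
                                     (trans tight (count-punchIn-≡ t zero refl)))
    hit′ : ∀ x → ∃[ y ] s (punchIn y₀ y) ≡ t (suc x)
    hit′ x with y , sy≡ ← hit (suc x) with y₀ ≟ᶠ y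
    ... | no y₀≢y = punchOut y₀≢y , trans (cong s (punchIn-punchOut y₀≢y)) sy≡
    ... | yes refl = count>0⇒preimage (s ∘ punchIn y₀)
      (subst (0 <_) (sym remaining′) (count-image>0 (t ∘ suc) x))
      where
      remaining′ : count (s ∘ punchIn y₀) (t (suc x)) ≡ count (t ∘ suc) (t (suc x))
      remaining′ = subst (λ τ → count (s ∘ punchIn y₀) τ ≡ count (t ∘ suc) τ)
                         (trans (sym sy₀) sy≡) remaining

InImage : ∀ {k} {V : Set} → (Fin k → V) → V → Set
InImage f v = ∃[ i ] f i ≡ v

record VertexCover (D : Digraph) (k : ℕ) : Set where
  field
    vertex : Fin k → Vertex D
    covers : ∀ u v → Edge D u v → u ≢ v → InImage vertex u ⊎ InImage vertex v

module _ {D : Digraph} where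

  open DisjointEdgeSet

  endpoint : ∀ {j} → DisjointEdgeSet D j → Fin j ⊎ Fin j → Vertex D
  endpoint M = endpoints (src M) (tgt M)

  Touches : ∀ {j} → DisjointEdgeSet D j → Vertex D → Set
  Touches M v = ∃[ e ] endpoint M e ≡ v

  touches? : ∀ {j} (M : DisjointEdgeSet D j) v → Dec (Touches M v)
  touches? M v with any? (λ i → src M i ≟ᶠ v) | any? (λ i → tgt M i ≟ᶠ v)
  ... | yes (i , p) | _           = yes (inj₁ i , p)
  ... | no _        | yes (i , p) = yes (inj₂ i , p)
  ... | no ¬s       | no ¬t       = no λ { (inj₁ i , p) → ¬s (i , p) ; (inj₂ i , p) → ¬t (i , p) }

  Maximal : ∀ {j} → DisjointEdgeSet D j → Set
  Maximal M = ∀ u v → Edge D u v → u ≢ v → Touches M u ⊎ Touches M v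

  emptyEdgeSet : DisjointEdgeSet D 0
  emptyEdgeSet = record
    { src = λ () ; tgt = λ () ; isEdge = λ () ; distinct = λ { {inj₁ ()} ; {inj₂ ()} } }

  extend : ∀ {j} (M : DisjointEdgeSet D j) {u v} → Edge D u v → u ≢ v →
           ¬ Touches M u → ¬ Touches M v → DisjointEdgeSet D (suc j)
  extend {j} M {u} {v} uv u≢v ¬u ¬v = record
    { src = u Vector.∷ src M ; tgt = v Vector.∷ tgt M ; isEdge = isEdge′ ; distinct = distinct′ }
    where
    isEdge′ : ∀ i → Edge D ((u Vector.∷ src M) i) ((v Vector.∷ tgt M) i)
    isEdge′ zero    = uv
    isEdge′ (suc i) = isEdge M i
    distinct′ : Injective _≡_ _≡_ (endpoints (u Vector.∷ src M) (v Vector.∷ tgt M))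
    distinct′ {inj₁ zero}    {inj₁ zero}    _ = refl
    distinct′ {inj₁ zero}    {inj₂ zero}    p = contradiction p u≢v
    distinct′ {inj₂ zero}    {inj₁ zero}    p = contradiction (sym p) u≢v
    distinct′ {inj₂ zero}    {inj₂ zero}    _ = refl
    distinct′ {inj₁ zero}    {inj₁ (suc i)} p = contradiction (inj₁ i , sym p) ¬u
    distinct′ {inj₁ zero}    {inj₂ (suc i)} p = contradiction (inj₂ i , sym p) ¬u
    distinct′ {inj₂ zero}    {inj₁ (suc i)} p = contradiction (inj₁ i , sym p) ¬v
    distinct′ {inj₂ zero}    {inj₂ (suc i)} p = contradiction (inj₂ i , sym p) ¬v
    distinct′ {inj₁ (suc i)} {inj₁ zero}    p = contradiction (inj₁ i , p) ¬u
    distinct′ {inj₂ (suc i)} {inj₁ zero}    p = contradiction (inj₂ i , p) ¬u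
    distinct′ {inj₁ (suc i)} {inj₂ zero}    p = contradiction (inj₁ i , p) ¬v
    distinct′ {inj₂ (suc i)} {inj₂ zero}    p = contradiction (inj₂ i , p) ¬v
    distinct′ {inj₁ (suc i)} {inj₁ (suc k)} p with refl ← distinct M {inj₁ i} {inj₁ k} p = refl
    distinct′ {inj₁ (suc i)} {inj₂ (suc k)} p with () ← distinct M {inj₁ i} {inj₂ k} p
    distinct′ {inj₂ (suc i)} {inj₁ (suc k)} p with () ← distinct M {inj₂ i} {inj₁ k} p
    distinct′ {inj₂ (suc i)} {inj₂ (suc k)} p with refl ← distinct M {inj₂ i} {inj₂ k} p = refl

  maximal-or-extend : ∀ {j} (M : DisjointEdgeSet D j) → Maximal M ⊎ DisjointEdgeSet D (suc j)
  maximal-or-extend M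
    with any? (λ u → any? (λ v →
           (edge D u v ≟ᵇ true) ×-dec ¬? (u ≟ᶠ v) ×-dec ¬? (touches? M u) ×-dec ¬? (touches? M v)))
  ... | yes (u , v , uv , u≢v , ¬u , ¬v) = inj₂ (extend M uv u≢v ¬u ¬v)
  ... | no none = inj₁ maximal
    where
    maximal : Maximal M
    maximal u v uv u≢v with touches? M u | touches? M v
    ... | yes tu | _      = inj₁ tu
    ... | no _   | yes tv = inj₂ tv
    ... | no ¬u  | no ¬v  = contradiction (u , v , uv , u≢v , ¬u , ¬v) none

  maximalDisjointEdgeSet : ∀ {N} → (∀ k → DisjointEdgeSet D k → k ≤ N) →
                           ∀ steps {j} → DisjointEdgeSet D j → N < j + steps →
                           ∃[ j ] Σ (DisjointEdgeSet D j) Maximal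
  maximalDisjointEdgeSet {N} bounded zero {j} M N<j =
    contradiction (bounded j M) (<⇒≱ (subst (N <_) (+-identityʳ j) N<j))
  maximalDisjointEdgeSet {N} bounded (suc steps) {j} M N<j+steps with maximal-or-extend M
  ... | inj₁ maximal = j , M , maximal
  ... | inj₂ M′      =
    maximalDisjointEdgeSet bounded steps M′ (subst (N <_) (+-suc j steps) N<j+steps)

  vertexCover : ∀ {j} (M : DisjointEdgeSet D j) → Maximal M → VertexCover D (j + j)
  vertexCover {j} M maximal = record { vertex = endpoint M ∘ splitAt j ; covers = covers }
    where
    asIndex : ∀ {v} → Touches M v → InImage (endpoint M ∘ splitAt j) v
    asIndex (e , p) = join j j e , trans (cong (endpoint M) (splitAt-join j j e)) p
    covers : ∀ u v → Edge D u v → u ≢ v →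
             InImage (endpoint M ∘ splitAt j) u ⊎ InImage (endpoint M ∘ splitAt j) v
    covers u v uv u≢v = Sum.map asIndex asIndex (maximal u v uv u≢v)

  boundedVertexCover : ∀ {N} → (∀ k → DisjointEdgeSet D k → k ≤ N) →
                       ∃[ k ] k ≤ N + N × VertexCover D k
  boundedVertexCover {N} bounded
    with j , M , maximal ← maximalDisjointEdgeSet bounded (suc N) emptyEdgeSet (s≤s ≤-refl) =
    j + j , +-mono-≤ (bounded j M) (bounded j M) , vertexCover M maximal

data Probe (k : ℕ) : Set where
  loop : Probe k
  at from to : Fin k → Probe k

probes : ∀ k → List (Probe k)
probes k = loop ∷ map at (allFin k) ++ map from (allFin k) ++ map to (allFin k)

∈-probes : ∀ {k} (p : Probe k) → p ∈ probes k
∈-probes loop     = here refl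
∈-probes (at i)   = there (∈-++⁺ˡ (∈-map⁺ at (∈-allFin i)))
∈-probes {k} (from i) = there (∈-++⁺ʳ (map at (allFin k)) (∈-++⁺ˡ (∈-map⁺ from (∈-allFin i))))
∈-probes {k} (to i)   =
  there (∈-++⁺ʳ (map at (allFin k)) (∈-++⁺ʳ (map from (allFin k)) (∈-map⁺ to (∈-allFin i))))

map-≡⇒≡ : ∀ {A B : Set} (f g : A → B) {xs} → map f xs ≡ map g xs → ∀ {x} → x ∈ xs → f x ≡ g x
map-≡⇒≡ f g eq (here refl) = proj₁ (∷-injective eq)
map-≡⇒≡ f g eq (there x∈)  = map-≡⇒≡ f g (proj₂ (∷-injective eq)) x∈

module _ {D : Digraph} {k} (C : VertexCover D k) where

  open VertexCover C

  answer : Probe k → Vertex D → Bool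
  answer loop     v = edge D v v
  answer (at i)   v = does (vertex i ≟ᶠ v)
  answer (from i) v = edge D (vertex i) v
  answer (to i)   v = edge D v (vertex i)

  vertexType : Vertex D → List Bool
  vertexType v = map (λ p → answer p v) (probes k)

does-true⇒ : {P : Set} (d : Dec P) → does d ≡ true → P
does-true⇒ (yes p) _  = p
does-true⇒ (no _)  ()

module _ {A B : Digraph} {k} (CA : VertexCover A k) (CB : VertexCover B k)
         (φ : Vertex B → Vertex A) (preserves : ∀ v → vertexType CA (φ v) ≡ vertexType CB v)
         where

  private
    module A = VertexCover CA
    module B = VertexCover CB

  answer-preserved : ∀ p v → answer CA p (φ v) ≡ answer CB p v
  answer-preserved p v =
    map-≡⇒≡ (λ q → answer CA q (φ v)) (λ q → answer CB q v) (preserves v) (∈-probes p)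

  -- The probes `at i` force φ to respect the covers, so the covers of A and B are
  -- never compared directly.
  φ-on-cover : ∀ i → A.vertex i ≡ φ (B.vertex i)
  φ-on-cover i = does-true⇒ (A.vertex i ≟ᶠ φ (B.vertex i))
    (trans (answer-preserved (at i) (B.vertex i)) (dec-true (B.vertex i ≟ᶠ B.vertex i) refl))

  covered-reflected : ∀ {v} → InImage A.vertex (φ v) → InImage B.vertex v
  covered-reflected {v} (i , p) =
    i , does-true⇒ (B.vertex i ≟ᶠ v)
          (trans (sym (answer-preserved (at i) v)) (dec-true (A.vertex i ≟ᶠ φ v) p))

  edge-preserved : ∀ u v → InImage B.vertex u ⊎ InImage B.vertex v ⊎ u ≡ v →
                   edge A (φ u) (φ v) ≡ edge B u v
  edge-preserved u v (inj₁ (i , refl)) = begin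
    edge A (φ (B.vertex i)) (φ v) ≡⟨ cong (λ w → edge A w (φ v)) (φ-on-cover i) ⟨
    edge A (A.vertex i) (φ v)     ≡⟨ answer-preserved (from i) v ⟩
    edge B (B.vertex i) v         ∎
    where open ≡-Reasoning
  edge-preserved u v (inj₂ (inj₁ (i , refl))) = begin
    edge A (φ u) (φ (B.vertex i)) ≡⟨ cong (edge A (φ u)) (φ-on-cover i) ⟨
    edge A (φ u) (A.vertex i)     ≡⟨ answer-preserved (to i) u ⟩
    edge B u (B.vertex i)         ∎
    where open ≡-Reasoning
  edge-preserved u v (inj₂ (inj₂ refl)) = answer-preserved loop u

  isStrongHom : IsStrongHom B A φ
  isStrongHom = isHom , reflects
    where
    isHom : IsHom B A φ
    isHom u v uv with u ≟ᶠ v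
    ... | yes u≡v = trans (edge-preserved u v (inj₂ (inj₂ u≡v))) uv
    ... | no  u≢v = trans (edge-preserved u v (Sum.map₂ inj₁ (B.covers u v uv u≢v))) uv
    reflects : ∀ s₁ s₂ → Edge A (φ s₁) (φ s₂) →
               ∃[ u₁ ] ∃[ u₂ ] (Edge B u₁ u₂ × φ u₁ ≡ φ s₁ × φ u₂ ≡ φ s₂)
    reflects s₁ s₂ e with φ s₁ ≟ᶠ φ s₂
    ... | yes φs₁≡φs₂ =
      s₁ , s₁ , trans (sym (edge-preserved s₁ s₁ (inj₂ (inj₂ refl))))
                      (subst (Edge A (φ s₁)) (sym φs₁≡φs₂) e)
           , refl , φs₁≡φs₂
    ... | no  φs₁≢φs₂ =
      s₁ , s₂ , trans (sym (edge-preserved s₁ s₂ covered)) e , refl , refl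
      where
      covered : InImage B.vertex s₁ ⊎ InImage B.vertex s₂ ⊎ s₁ ≡ s₂
      covered = Sum.map covered-reflected (inj₁ ∘ covered-reflected)
                        (A.covers (φ s₁) (φ s₂) e φs₁≢φs₂)

  typePreserving⇒⪯strong : Surjective φ → A ⪯strong B
  typePreserving⇒⪯strong onto = φ , isStrongHom , onto

boolLists : ℕ → List (List Bool)
boolLists zero    = [] ∷ []
boolLists (suc n) = [] ∷ map (true ∷_) (boolLists n) ++ map (false ∷_) (boolLists n)

∈-boolLists : ∀ {n} (bs : List Bool) → length bs ≤ n → bs ∈ boolLists n
∈-boolLists {zero}  []           _         = here refl
∈-boolLists {suc n} []           _         = here refl
∈-boolLists {suc n} (true ∷ bs)  (s≤s len) = there (∈-++⁺ˡ (∈-map⁺ (true ∷_) (∈-boolLists bs len)))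
∈-boolLists {suc n} (false ∷ bs) (s≤s len) =
  there (∈-++⁺ʳ (map (true ∷_) (boolLists n)) (∈-map⁺ (false ∷_) (∈-boolLists bs len)))

length-probes : ∀ k → length (probes k) ≡ suc (k + (k + k))
length-probes k = cong suc (begin
  length (map at fs ++ map from fs ++ map to fs)
    ≡⟨ length-++ (map at fs) ⟩
  length (map at fs) + length (map from fs ++ map to fs)
    ≡⟨ cong (length (map at fs) +_) (length-++ (map from fs)) ⟩
  length (map at fs) + (length (map from fs) + length (map to fs))
    ≡⟨ cong₂ _+_ (length-fs at) (cong₂ _+_ (length-fs from) (length-fs to)) ⟩
  k + (k + k) ∎)
  where
  open ≡-Reasoning
  fs : List (Fin k)
  fs = allFin k
  length-fs : (c : Fin k → Probe k) → length (map c fs) ≡ k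
  length-fs c = trans (length-map c fs) (length-tabulate id)

probes-length-mono : ∀ {k K} → k ≤ K → length (probes k) ≤ length (probes K)
probes-length-mono {k} {K} k≤K = subst₂ _≤_ (sym (length-probes k)) (sym (length-probes K))
  (s≤s (+-mono-≤ k≤K (+-mono-≤ k≤K k≤K)))

record CoveredDigraph (K : ℕ) : Set where
  constructor covered
  field
    graph     : Digraph
    coverSize : ℕ
    small     : coverSize ≤ K
    cover     : VertexCover graph coverSize

open Counting (≡-dec _≟ᵇ_)

module _ {K : ℕ} where

  open CoveredDigraph

  typeCount : CoveredDigraph K → List Bool → ℕ
  typeCount X = count (vertexType (cover X))

  typeCodes : List (List Bool)
  typeCodes = boolLists (length (probes K))

  vertexType∈typeCodes : (X : CoveredDigraph K) (v : Vertex (graph X)) →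
                         vertexType (cover X) v ∈ typeCodes
  vertexType∈typeCodes X v = ∈-boolLists _
    (≤-trans (≤-reflexive (length-map _ (probes (coverSize X)))) (probes-length-mono (small X)))

  _≼_ : CoveredDigraph K → CoveredDigraph K → Set
  _≼_ = ((λ j k → j ∈ upTo (suc K) → j ≡ k) on coverSize)
      ∩ ((λ c d → All (λ τ → c τ ⊑ d τ) typeCodes) on typeCount)

  almostFull-≼ : AlmostFull _≼_
  almostFull-≼ = almostFull-∩ (almostFull-on coverSize (almostFull-≡ _≟ℕ_ (upTo (suc K))))
                              (almostFull-on typeCount (almostFull-All almostFull-⊑ typeCodes))

  ≼⇒⪯strong : ∀ {X Y} → X ≼ Y → graph X ⪯strong graph Y
  ≼⇒⪯strong {covered A k k≤K CA} {covered B _ k′≤K CB} (sameSize , dominated)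
    with refl ← sameSize (∈-upTo⁺ (s≤s k≤K)) =
    let φ , preserves , onto = labelledSurjection (vertexType CB) (vertexType CA) fewer hit
    in typePreserving⇒⪯strong CA CB φ preserves onto
    where
    A′ B′ : CoveredDigraph K
    A′ = covered A k k≤K CA
    B′ = covered B k k′≤K CB
    fewer : ∀ τ → typeCount A′ τ ≤ typeCount B′ τ
    fewer τ with typeCount A′ τ ≟ℕ 0
    ... | yes none = subst (_≤ typeCount B′ τ) (sym none) z≤n
    ... | no  some with y , refl ← count>0⇒preimage (vertexType CA) (n≢0⇒n>0 some) =
      proj₁ (lookup dominated (vertexType∈typeCodes A′ y))
    hit : ∀ x → ∃[ y ] vertexType CA y ≡ vertexType CB x
    hit x = count>0⇒preimage (vertexType CA) (n≢0⇒n>0 λ none →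
      <⇒≢ (count-image>0 (vertexType CB) x)
          (sym (proj₂ (lookup dominated (vertexType∈typeCodes B′ x)) none)))

⪯hom-refl : Reflexive _⪯hom_
⪯hom-refl = id , (λ _ _ e → e) , λ b → b , refl

⪯hom-trans : Transitive _⪯hom_
⪯hom-trans (φ , φ-hom , φ-onto) (ψ , ψ-hom , ψ-onto) =
  φ ∘ ψ , (λ _ _ → φ-hom _ _ ∘ ψ-hom _ _) , onto
  where
  onto : Surjective (φ ∘ ψ)
  onto a with b , refl ← φ-onto a with c , refl ← ψ-onto b = c , refl

⪯strong-refl : Reflexive _⪯strong_
⪯strong-refl = id , ((λ _ _ e → e) , λ s₁ s₂ e → s₁ , s₂ , e , refl , refl) , λ b → b , refl

⪯strong-trans : Transitive _⪯strong_
⪯strong-trans {A} {B} {C} (φ , (φ-hom , φ-strong) , φ-onto) (ψ , (ψ-hom , ψ-strong) , ψ-onto) =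
  φ ∘ ψ , ((λ _ _ → φ-hom _ _ ∘ ψ-hom _ _) , strong) , onto
  where
  strong : ∀ s₁ s₂ → Edge A (φ (ψ s₁)) (φ (ψ s₂)) →
           ∃[ u₁ ] ∃[ u₂ ] (Edge C u₁ u₂ × φ (ψ u₁) ≡ φ (ψ s₁) × φ (ψ u₂) ≡ φ (ψ s₂))
  strong s₁ s₂ e
    with u₁ , u₂ , e′ , p₁ , p₂ ← φ-strong (ψ s₁) (ψ s₂) e
    with w₁ , refl ← ψ-onto u₁ | w₂ , refl ← ψ-onto u₂
    with x₁ , x₂ , e″ , q₁ , q₂ ← ψ-strong w₁ w₂ e′
    = x₁ , x₂ , e″ , trans (cong φ q₁) p₁ , trans (cong φ q₂) p₂
  onto : Surjective (φ ∘ ψ)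
  onto a with b , refl ← φ-onto a with c , refl ← ψ-onto b = c , refl

⪯strong⇒⪯hom : ∀ {A B} → A ⪯strong B → A ⪯hom B
⪯strong⇒⪯hom (φ , (φ-hom , _) , φ-onto) = φ , φ-hom , φ-onto

Good : (Digraph → Digraph → Set) → Class → Set
Good _⪯_ 𝒞 = (f : ℕ → Member 𝒞) → ∃[ i ] ∃[ j ] (i < j × proj₁ (f i) ⪯ proj₁ (f j))

good-mono : {_⪯_ _⊴_ : Digraph → Digraph → Set} {𝒞 : Class} →
            (∀ {A B} → A ⪯ B → A ⊴ B) → Good _⪯_ 𝒞 → Good _⊴_ 𝒞
good-mono ⪯⇒⊴ good f with i , j , i<j , fi⪯fj ← good f = i , j , i<j , ⪯⇒⊴ fi⪯fj

module _ {_⪯_ : Digraph → Digraph → Set} (refl⪯ : Reflexive _⪯_) (trans⪯ : Transitive _⪯_) where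

  descending⇒⪯ : (D : ℕ → Digraph) → (∀ i → D (suc i) ⪯ D i) → ∀ k i → D (k + i) ⪯ D i
  descending⇒⪯ D step zero    i = refl⪯
  descending⇒⪯ D step (suc k) i = trans⪯ (step (k + i)) (descending⇒⪯ D step k i)

  good⇒wellQuasiOrdered : ∀ {𝒞} → Good _⪯_ 𝒞 → WellQuasiOrdered _⪯_ 𝒞
  good⇒wellQuasiOrdered {𝒞} good = noDescending , noAntichain
    where
    noDescending : NoInfiniteDescending _⪯_ 𝒞
    noDescending (f , descending) with i , j , i<j , fi⪯fj ← good f =
      proj₂ (descending i) (trans⪯ fi⪯fj fj⪯fi+1)
      where
      D : ℕ → Digraph
      D = proj₁ ∘ f
      fj⪯fi+1 : D j ⪯ D (suc i)
      fj⪯fi+1 = subst (λ n → D n ⪯ D (suc i)) (m∸n+n≡m i<j)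
                      (descending⇒⪯ D (proj₁ ∘ descending) (j ∸ suc i) (suc i))
    noAntichain : NoInfiniteAntichain _⪯_ 𝒞
    noAntichain (f , antichain) with i , j , i<j , fi⪯fj ← good f = antichain i j (<⇒≢ i<j) fi⪯fj

disjointEdgeBounded⇒good : ∀ {𝒞 N} → DisjointEdgeBounded 𝒞 N → Good _⪯strong_ 𝒞
disjointEdgeBounded⇒good {𝒞} {N} bounded f =
  let i , j , i<j , Xi≼Xj = almostFull-good (almostFull-≼ {N + N}) (covering ∘ f)
  in i , j , i<j , ≼⇒⪯strong {X = covering (f i)} {covering (f j)} Xi≼Xj
  where
  covering : Member 𝒞 → CoveredDigraph (N + N)
  covering (D , D∈𝒞) =
    let k , k≤N+N , C = boundedVertexCover (bounded D D∈𝒞) in covered D k k≤N+N C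

corollary2p2 : (𝒞 : Class) → ∃[ N ] DisjointEdgeBounded 𝒞 N →
    WellQuasiOrdered _⪯hom_ 𝒞 × WellQuasiOrdered _⪯strong_ 𝒞
corollary2p2 𝒞 (N , bounded) =
  good⇒wellQuasiOrdered ⪯hom-refl (λ {A B C} → ⪯hom-trans {A} {B} {C})
    (good-mono (λ {A B} → ⪯strong⇒⪯hom {A} {B}) good) ,
  good⇒wellQuasiOrdered ⪯strong-refl (λ {A B C} → ⪯strong-trans {A} {B} {C}) good
  where
  good : Good _⪯strong_ 𝒞
  good = disjointEdgeBounded⇒good bounded
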